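{- Binary strings $s$ and $t$ are equicomposable if and only if $P_sP_s^*=P_tP_t^*$.
   Context: For a binary string $s=s_1\cdots s_n$, let $a_i,b_i$ be the numbers of 0's and 1's among $s_1,\dots,s_i$; the generating polynomial is $P_s(x,y)=\sum_{i=0}^n x^{a_i}y^{b_i}\in\mathbb Z[x,y]$. For $P\in\mathbb Z[x,y]$ the reciprocal is $P^*(x,y)=x^{\deg_xP}y^{\deg_yP}P(1/x,1/y)$. Strings $s,t$ are equicomposable if the multisets of compositions (numbers of 0's and 1's) of all their contiguous substrings coincide. -}

module Defs where

open import Data.Bool using (Bool; true; false; if_then_else_)
open import Data.Nat as ℕ using (ℕ; zero; suc; _⊔_; _∸_)
open import Data.Integer as ℤ using (ℤ)
open import Data.List using (List; []; _∷_; map; _++_; foldr; concatMap)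
open import Data.Product using (_×_; _,_)
open import Relation.Nullary using (yes; no)
open import Relation.Nullary.Decidable using (⌊_⌋)
open import Data.List.Relation.Binary.Permutation.Propositional using (_↭_)
open import Relation.Binary.PropositionalEquality using (_≡_)

-- Binary strings: false = 0, true = 1.
BinStr : Set
BinStr = List Bool

comp : BinStr → ℕ × ℕ
comp [] = 0 , 0
comp (false ∷ s) with comp s
... | a , b = suc a , b
comp (true ∷ s) with comp s
... | a , b = a , suc b

nePrefixes : BinStr → List BinStr
nePrefixes [] = []
nePrefixes (c ∷ s) = (c ∷ []) ∷ map (c ∷_) (nePrefixes s)

-- All nonempty contiguous substrings (one entry per position pair i < j).
substrings : BinStr → List BinStr
substrings [] = []
substrings (c ∷ s) = nePrefixes (c ∷ s) ++ substrings s

compositions : BinStr → List (ℕ × ℕ)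
compositions s = map comp (substrings s)

Equicomposable : BinStr → BinStr → Set
Equicomposable s t = compositions s ↭ compositions t

-- Polynomials in ℤ[x,y], as finite lists of terms  c · x^i y^j
-- (the polynomial is the sum of its terms; repeated exponents allowed).

Term : Set
Term = ℤ × ℕ × ℕ

Poly : Set
Poly = List Term

coeff : Poly → ℕ → ℕ → ℤ
coeff [] a b = ℤ.0ℤ
coeff ((c , i , j) ∷ p) a b =
  (if ⌊ i ℕ.≟ a ⌋ then (if ⌊ j ℕ.≟ b ⌋ then c else ℤ.0ℤ) else ℤ.0ℤ) ℤ.+ coeff p a b

_≈ₚ_ : Poly → Poly → Set
p ≈ₚ q = ∀ a b → coeff p a b ≡ coeff q a b

_*ₚ_ : Poly → Poly → Poly
p *ₚ q = concatMap (λ { (c , i , j) → map (λ { (d , k , l) → (c ℤ.* d , i ℕ.+ k , j ℕ.+ l) }) q }) p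

-- Degrees in x and y: maximum exponent over monomials with nonzero
-- coefficient (0 for the zero polynomial).
degx : Poly → ℕ
degx p = foldr (λ { (_ , i , j) m → if ⌊ coeff p i j ℤ.≟ ℤ.0ℤ ⌋ then m else i ⊔ m }) 0 p

degy : Poly → ℕ
degy p = foldr (λ { (_ , i , j) m → if ⌊ coeff p i j ℤ.≟ ℤ.0ℤ ⌋ then m else j ⊔ m }) 0 p

-- Reciprocal P*(x,y) = x^{deg_x P} y^{deg_y P} P(1/x,1/y).
-- (Terms with exponents beyond the degrees belong to exponent classes whose
-- total coefficient is 0; truncated subtraction maps whole classes together,
-- so they still contribute 0.)
reciprocal : Poly → Poly
reciprocal p = map (λ { (c , i , j) → (c , degx p ∸ i , degy p ∸ j) }) p

genPoly : BinStr → Poly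
genPoly [] = (ℤ.1ℤ , 0 , 0) ∷ []
genPoly (false ∷ s) = (ℤ.1ℤ , 0 , 0) ∷ map (λ { (c , i , j) → (c , suc i , j) }) (genPoly s)
genPoly (true ∷ s) = (ℤ.1ℤ , 0 , 0) ∷ map (λ { (c , i , j) → (c , i , suc j) }) (genPoly s)

-- Write p₀, …, pₙ for the prefix points (aᵢ , bᵢ) of s and T = pₙ = comp s. Then
-- P_s = Σ x^pᵢ and P_s* = Σ x^(T − pⱼ), so the exponents of P_s P_s* form the multiset T + D_s,
-- where D_s = {pᵢ − pⱼ} ranges over all ordered pairs. The pairs i > j contribute the
-- compositions of the substrings, the pairs i < j their negatives, and the diagonal n + 1 zeros.
-- Equicomposable strings have the same largest composition T and hence the same n, so D_s = D_t.
-- Conversely the exponents of the product peak at T + T, which determines T and then D_s, and the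
-- compositions are recovered as the elements of D_s in the nonnegative quadrant other than 0.

module Submission where

open import Defs
open import Data.Bool using (Bool; true; false; if_then_else_)
open import Data.Integer as ℤ using (ℤ; +_)
import Data.Integer.Properties as ℤ
open import Data.Integer.Tactic.RingSolver using (solve-∀)
import Algebra.Solver.CommutativeMonoid as BagSolver
open import Data.List
  using ( List; []; _∷_; [_]; _++_; map; length; foldr; replicate
        ; mapMaybe; catMaybes; cartesianProductWith)
open import Data.List.Properties
  using ( map-∘; map-++; map-cong; map-cong-local; map-id; length-map; ++-identityʳ
        ; mapMaybe-++; mapMaybe-map; mapMaybe-just; mapMaybe-nothing)
open import Data.List.Membership.Propositional using (_∈_)
open import Data.List.Membership.Propositional.Properties
  using (∈-∃++; ∈-map⁺; ∈-++⁺ˡ; ∈-cartesianProductWith⁺)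
open import Data.List.Relation.Unary.All as All using (All; []; _∷_)
import Data.List.Relation.Unary.All.Properties as All
open import Data.List.Relation.Unary.Any using (here; there)
open import Data.List.Relation.Binary.Permutation.Propositional
  using (_↭_; ↭-refl; ↭-trans; ↭-sym; prep; ↭⇒↭ₛ; module PermutationReasoning)
import Data.List.Relation.Binary.Permutation.Propositional.Properties as ↭
open import Data.List.Relation.Binary.Permutation.Setoid.Properties using (foldr-commMonoid)
open import Data.Maybe using (Maybe; just; nothing)
open import Data.Nat as ℕ using (ℕ; zero; suc; _+_; _∸_; _⊔_; _≤_; _<_; z≤n; z<s)
import Data.Nat.Properties as ℕ
open import Data.Nat.ListAction using (sum)
open import Data.Nat.ListAction.Properties using (sum-↭)
open import Data.Product using (_×_; _,_; proj₁; proj₂)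
open import Data.Product.Relation.Binary.Pointwise.NonDependent
  using (×-decidable; ≡×≡⇒≡; ≡⇒≡×≡)
open import Function using (_∘_; _⇔_; mk⇔)
import Function.Properties.Equivalence as ⇔
open import Relation.Binary.Definitions using (DecidableEquality)
open import Relation.Binary.PropositionalEquality
  using (_≡_; _≢_; refl; sym; trans; cong; cong₂; subst; subst₂; setoid; module ≡-Reasoning)
open import Relation.Nullary using (Dec; yes; no; does; contradiction; _×-dec_)
open import Relation.Nullary.Decidable using (⌊_⌋; map′)

module Multiplicity {A : Set} (_≟_ : DecidableEquality A) where

  count : A → List A → ℕ
  count v = sum ∘ map (λ x → if does (x ≟ v) then 1 else 0)

  count-↭ : ∀ {xs ys} → xs ↭ ys → ∀ v → count v xs ≡ count v ys
  count-↭ p v = sum-↭ (↭.map⁺ _ p)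

  count-∈⁺ : ∀ {v xs} → v ∈ xs → 0 < count v xs
  count-∈⁺ {v} {x ∷ xs} v∈ with x ≟ v | v∈
  ... | yes _ | _ = z<s
  ... | no x≢v | here v≡x = contradiction (sym v≡x) x≢v
  ... | no _ | there v∈xs = count-∈⁺ v∈xs

  count-∈⁻ : ∀ {v xs} → 0 < count v xs → v ∈ xs
  count-∈⁻ {v} {x ∷ xs} 0<n with x ≟ v
  ... | yes x≡v = here (sym x≡v)
  ... | no _ = there (count-∈⁻ 0<n)

  ∈-resp-count : ∀ {v xs ys} → count v xs ≡ count v ys → v ∈ xs → v ∈ ys
  ∈-resp-count {ys = ys} e v∈xs = count-∈⁻ {xs = ys} (subst (0 <_) e (count-∈⁺ v∈xs))

  count⇒↭ : ∀ xs ys → (∀ v → count v xs ≡ count v ys) → xs ↭ ys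
  count⇒↭ [] [] _ = ↭-refl
  count⇒↭ [] (y ∷ ys) h =
    contradiction (∈-resp-count {xs = y ∷ ys} {ys = []} (sym (h y)) (here refl)) λ ()
  count⇒↭ (x ∷ xs) ys h with ∈-∃++ (∈-resp-count {xs = x ∷ xs} {ys = ys} (h x) (here refl))
  ... | ys₁ , ys₂ , refl =
    ↭-trans (prep x (count⇒↭ xs (ys₁ ++ ys₂) h′)) (↭-sym (↭.shift x ys₁ ys₂))
    where
    h′ : ∀ v → count v xs ≡ count v (ys₁ ++ ys₂)
    h′ v = ℕ.+-cancelˡ-≡ _ _ _ (trans (h v) (count-↭ (↭.shift x ys₁ ys₂) v))

↭-map⁻ : ∀ {A B : Set} {f : A → B} (g : B → A) → (∀ x → g (f x) ≡ x) →
         ∀ {xs ys} → map f xs ↭ map f ys → xs ↭ ys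
↭-map⁻ {f = f} g g∘f≗id {xs} {ys} p = subst₂ _↭_ (retract xs) (retract ys) (↭.map⁺ g p)
  where
  retract : ∀ zs → map g (map f zs) ≡ zs
  retract zs = trans (sym (map-∘ zs)) (trans (map-cong g∘f≗id zs) (map-id zs))

mapMaybe-cong-local : ∀ {A B : Set} {f g : A → Maybe B} {xs} →
                      All (λ x → f x ≡ g x) xs → mapMaybe f xs ≡ mapMaybe g xs
mapMaybe-cong-local = cong catMaybes ∘ map-cong-local

foldr-⊔-↭ : ∀ {ms ns} → ms ↭ ns → foldr _⊔_ 0 ms ≡ foldr _⊔_ 0 ns
foldr-⊔-↭ p = foldr-commMonoid (setoid ℕ) ℕ.⊔-0-isCommutativeMonoid (↭⇒↭ₛ p)

foldr-⊔-lub : ∀ {m ns} → All (_≤ m) ns → foldr _⊔_ 0 ns ≤ m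
foldr-⊔-lub [] = z≤n
foldr-⊔-lub (n≤m ∷ ns≤m) = ℕ.⊔-lub n≤m (foldr-⊔-lub ns≤m)

≤-foldr-⊔ : ∀ {m ns} → m ∈ ns → m ≤ foldr _⊔_ 0 ns
≤-foldr-⊔ {m} {n ∷ ns} (here refl) = ℕ.m≤m⊔n m _
≤-foldr-⊔ {m} {n ∷ ns} (there m∈ns) = ℕ.≤-trans (≤-foldr-⊔ m∈ns) (ℕ.m≤n⊔m n _)

foldr-⊔-attained : ∀ {m ns} → m ∈ ns → All (_≤ m) ns → foldr _⊔_ 0 ns ≡ m
foldr-⊔-attained m∈ns ns≤m = ℕ.≤-antisym (foldr-⊔-lub ns≤m) (≤-foldr-⊔ m∈ns)

cartesianProductWith-∷ʳ : ∀ {A B C : Set} (f : A → B → C) xs y ys →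
  cartesianProductWith f xs (y ∷ ys) ↭ map (λ x → f x y) xs ++ cartesianProductWith f xs ys
cartesianProductWith-∷ʳ f [] y ys = ↭-refl
cartesianProductWith-∷ʳ f (x ∷ xs) y ys = prep (f x y) (begin
  map (f x) ys ++ cartesianProductWith f xs (y ∷ ys)
    ↭⟨ ↭.++⁺ˡ (map (f x) ys) (cartesianProductWith-∷ʳ f xs y ys) ⟩
  map (f x) ys ++ map (λ x → f x y) xs ++ cartesianProductWith f xs ys
    ↭⟨ ↭.shifts (map (f x) ys) (map (λ x → f x y) xs) ⟩
  map (λ x → f x y) xs ++ map (f x) ys ++ cartesianProductWith f xs ys ∎)
  where open PermutationReasoning

m+m≡n+n⇒m≡n : ∀ {m n} → m + m ≡ n + n → m ≡ n
m+m≡n+n⇒m≡n {m} {n} e = ℕ.*-cancelˡ-≡ m n 2 (begin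
  m + (m + 0) ≡⟨ cong (λ k → m + k) (ℕ.+-identityʳ m) ⟩
  m + m       ≡⟨ e ⟩
  n + n       ≡⟨ cong (λ k → n + k) (ℕ.+-identityʳ n) ⟨
  n + (n + 0) ∎)
  where open ≡-Reasoning

ℕ² : Set
ℕ² = ℕ × ℕ

_≟₂_ : DecidableEquality ℕ²
p ≟₂ q = map′ ≡×≡⇒≡ ≡⇒≡×≡ (×-decidable ℕ._≟_ ℕ._≟_ p q)

open Multiplicity _≟₂_

infixl 6 _+₂_ _∸₂_
infix 4 _≤₂_

_+₂_ : ℕ² → ℕ² → ℕ²
p +₂ q = (proj₁ p + proj₁ q , proj₂ p + proj₂ q)

_∸₂_ : ℕ² → ℕ² → ℕ²
p ∸₂ q = (proj₁ p ∸ proj₁ q , proj₂ p ∸ proj₂ q)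

_≤₂_ : ℕ² → ℕ² → Set
p ≤₂ q = proj₁ p ≤ proj₁ q × proj₂ p ≤ proj₂ q

+₂-monoʳ-≤₂ : ∀ u {p q} → p ≤₂ q → u +₂ p ≤₂ u +₂ q
+₂-monoʳ-≤₂ u (p₁≤q₁ , p₂≤q₂) = ℕ.+-monoʳ-≤ (proj₁ u) p₁≤q₁ , ℕ.+-monoʳ-≤ (proj₂ u) p₂≤q₂

p≤₂q⇒p≤₂u+₂q : ∀ u {p q} → p ≤₂ q → p ≤₂ u +₂ q
p≤₂q⇒p≤₂u+₂q u (p₁≤q₁ , p₂≤q₂) = ℕ.m≤n⇒m≤o+n (proj₁ u) p₁≤q₁ , ℕ.m≤n⇒m≤o+n (proj₂ u) p₂≤q₂

sup : List ℕ² → ℕ²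
sup L = (foldr _⊔_ 0 (map proj₁ L) , foldr _⊔_ 0 (map proj₂ L))

sup-↭ : ∀ {L M} → L ↭ M → sup L ≡ sup M
sup-↭ p = cong₂ _,_ (foldr-⊔-↭ (↭.map⁺ proj₁ p)) (foldr-⊔-↭ (↭.map⁺ proj₂ p))

sup-attained : ∀ {m L} → m ∈ L → All (_≤₂ m) L → sup L ≡ m
sup-attained m∈L L≤m = cong₂ _,_
  (foldr-⊔-attained (∈-map⁺ proj₁ m∈L) (All.map⁺ (All.map proj₁ L≤m)))
  (foldr-⊔-attained (∈-map⁺ proj₂ m∈L) (All.map⁺ (All.map proj₂ L≤m)))

-- Pairwise differences in ℤ²

ℤ² : Set
ℤ² = ℤ × ℤ

infixl 6 _+ᵥ_ _-ᵥ_

_+ᵥ_ : ℤ² → ℤ² → ℤ²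
x +ᵥ y = (proj₁ x ℤ.+ proj₁ y , proj₂ x ℤ.+ proj₂ y)

_-ᵥ_ : ℤ² → ℤ² → ℤ²
x -ᵥ y = (proj₁ x ℤ.- proj₁ y , proj₂ x ℤ.- proj₂ y)

negᵥ : ℤ² → ℤ²
negᵥ x = (ℤ.- proj₁ x , ℤ.- proj₂ x)

0ᵥ : ℤ²
0ᵥ = (+ 0 , + 0)

x-ᵥx≡0ᵥ : ∀ x → x -ᵥ x ≡ 0ᵥ
x-ᵥx≡0ᵥ x = cong₂ _,_ (ℤ.+-inverseʳ (proj₁ x)) (ℤ.+-inverseʳ (proj₂ x))

x-ᵥ0ᵥ≡x : ∀ x → x -ᵥ 0ᵥ ≡ x
x-ᵥ0ᵥ≡x x = cong₂ _,_ (ℤ.+-identityʳ (proj₁ x)) (ℤ.+-identityʳ (proj₂ x))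

negᵥ[x-ᵥy]≡y-ᵥx : ∀ x y → negᵥ (x -ᵥ y) ≡ y -ᵥ x
negᵥ[x-ᵥy]≡y-ᵥx x y = cong₂ _,_ (lemma (proj₁ x) (proj₁ y)) (lemma (proj₂ x) (proj₂ y))
  where
  lemma : ∀ (a b : ℤ) → ℤ.- (a ℤ.- b) ≡ b ℤ.- a
  lemma = solve-∀

[w+ᵥx]-ᵥw≡x : ∀ w x → (w +ᵥ x) -ᵥ w ≡ x
[w+ᵥx]-ᵥw≡x w x = cong₂ _,_ (lemma (proj₁ w) (proj₁ x)) (lemma (proj₂ w) (proj₂ x))
  where
  lemma : ∀ (c a : ℤ) → (c ℤ.+ a) ℤ.- c ≡ a
  lemma = solve-∀

[w+ᵥx]-ᵥ[w+ᵥy]≡x-ᵥy : ∀ w x y → (w +ᵥ x) -ᵥ (w +ᵥ y) ≡ x -ᵥ y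
[w+ᵥx]-ᵥ[w+ᵥy]≡x-ᵥy w x y =
  cong₂ _,_ (lemma (proj₁ w) (proj₁ x) (proj₁ y)) (lemma (proj₂ w) (proj₂ x) (proj₂ y))
  where
  lemma : ∀ (c a b : ℤ) → (c ℤ.+ a) ℤ.- (c ℤ.+ b) ≡ a ℤ.- b
  lemma = solve-∀

toℤ² : ℕ² → ℤ²
toℤ² p = (+ proj₁ p , + proj₂ p)

toℤ²-+₂-∸₂ : ∀ p {q T} → q ≤₂ T → toℤ² (p +₂ (T ∸₂ q)) ≡ toℤ² T +ᵥ (toℤ² p -ᵥ toℤ² q)
toℤ²-+₂-∸₂ p {q} {T} (q₁≤T₁ , q₂≤T₂) = cong₂ _,_ (coordinate q₁≤T₁) (coordinate q₂≤T₂)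
  where
  swap : ∀ (a t b : ℤ) → a ℤ.+ (t ℤ.- b) ≡ t ℤ.+ (a ℤ.- b)
  swap = solve-∀
  coordinate : ∀ {a b t} → b ≤ t → + (a + (t ∸ b)) ≡ + t ℤ.+ (+ a ℤ.- + b)
  coordinate {a} {b} {t} b≤t = begin
    + (a + (t ∸ b))         ≡⟨ ℤ.pos-+ a (t ∸ b) ⟩
    + a ℤ.+ + (t ∸ b)       ≡⟨ cong (λ d → + a ℤ.+ d) (trans (ℤ.m-n≡m⊖n t b) (ℤ.⊖-≥ b≤t)) ⟨
    + a ℤ.+ (+ t ℤ.- + b)   ≡⟨ swap (+ a) (+ t) (+ b) ⟩
    + t ℤ.+ (+ a ℤ.- + b)   ∎
    where open ≡-Reasoning

differences : List ℤ² → List ℤ²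
differences X = cartesianProductWith _-ᵥ_ X X

increments : List ℤ² → List ℤ²
increments [] = []
increments (x ∷ X) = map (_-ᵥ x) X ++ increments X

differences-↭ : ∀ X →
  differences X ↭ increments X ++ map negᵥ (increments X) ++ replicate (length X) 0ᵥ
differences-↭ [] = ↭-refl
differences-↭ (x ∷ X) = begin
  (x -ᵥ x) ∷ A ++ cartesianProductWith _-ᵥ_ X (x ∷ X)
    ↭⟨ prep _ (↭.++⁺ˡ A (↭-trans (cartesianProductWith-∷ʳ _-ᵥ_ X x X)
                                 (↭.++⁺ˡ B (differences-↭ X)))) ⟩
  (x -ᵥ x) ∷ A ++ B ++ C ++ map negᵥ C ++ R
    ≡⟨ cong (λ z → z ∷ A ++ B ++ C ++ map negᵥ C ++ R) (x-ᵥx≡0ᵥ x) ⟩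
  0ᵥ ∷ A ++ B ++ C ++ map negᵥ C ++ R
    ↭⟨ solve 6 (λ z a b c d r → z ⊕ (a ⊕ (b ⊕ (c ⊕ (d ⊕ r)))) ⊜ (b ⊕ c) ⊕ ((a ⊕ d) ⊕ (z ⊕ r))) ↭-refl
         [ 0ᵥ ] A B C (map negᵥ C) R ⟩
  (B ++ C) ++ (A ++ map negᵥ C) ++ 0ᵥ ∷ R
    ≡⟨ cong (λ z → (B ++ C) ++ z ++ 0ᵥ ∷ R)
            (trans (map-++ negᵥ B C) (cong (_++ map negᵥ C) negᵥB≡A)) ⟨
  (B ++ C) ++ map negᵥ (B ++ C) ++ 0ᵥ ∷ R ∎
  where
  open PermutationReasoning
  open BagSolver (↭.++-commutativeMonoid {A = ℤ²}) using (solve; _⊜_; _⊕_)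
  A B C R : List ℤ²
  A = map (x -ᵥ_) X
  B = map (_-ᵥ x) X
  C = increments X
  R = replicate (length X) 0ᵥ
  negᵥB≡A : map negᵥ B ≡ A
  negᵥB≡A = trans (sym (map-∘ X)) (map-cong (λ y → negᵥ[x-ᵥy]≡y-ᵥx y x) X)

increments-+ᵥ : ∀ w X → increments (map (w +ᵥ_) X) ≡ increments X
increments-+ᵥ w [] = refl
increments-+ᵥ w (x ∷ X) = cong₂ _++_
  (trans (sym (map-∘ X)) (map-cong (λ y → [w+ᵥx]-ᵥ[w+ᵥy]≡x-ᵥy w y x) X))
  (increments-+ᵥ w X)

toℤ²-cartesianProductWith : ∀ T X Y → All (_≤₂ T) Y →
  map toℤ² (cartesianProductWith _+₂_ X (map (T ∸₂_) Y))
    ≡ map (toℤ² T +ᵥ_) (cartesianProductWith _-ᵥ_ (map toℤ² X) (map toℤ² Y))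
toℤ²-cartesianProductWith T [] Y Y≤T = refl
toℤ²-cartesianProductWith T (x ∷ X) Y Y≤T = begin
  map toℤ² (row₊ ++ rest₊)            ≡⟨ map-++ toℤ² row₊ rest₊ ⟩
  map toℤ² row₊ ++ map toℤ² rest₊     ≡⟨ cong₂ _++_ (row Y Y≤T) (toℤ²-cartesianProductWith T X Y Y≤T) ⟩
  map shift row₋ ++ map shift rest₋   ≡⟨ map-++ shift row₋ rest₋ ⟨
  map shift (row₋ ++ rest₋)           ∎
  where
  open ≡-Reasoning
  shift : ℤ² → ℤ²
  shift = toℤ² T +ᵥ_
  row₊ rest₊ : List ℕ²
  row₊ = map (x +₂_) (map (T ∸₂_) Y)
  rest₊ = cartesianProductWith _+₂_ X (map (T ∸₂_) Y)
  row₋ rest₋ : List ℤ²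
  row₋ = map (toℤ² x -ᵥ_) (map toℤ² Y)
  rest₋ = cartesianProductWith _-ᵥ_ (map toℤ² X) (map toℤ² Y)
  row : ∀ Y → All (_≤₂ T) Y →
        map toℤ² (map (x +₂_) (map (T ∸₂_) Y)) ≡ map shift (map (toℤ² x -ᵥ_) (map toℤ² Y))
  row [] [] = refl
  row (y ∷ Y) (y≤T ∷ Y≤T) = cong₂ _∷_ (toℤ²-+₂-∸₂ x y≤T) (row Y Y≤T)

positivePart : ℤ² → Maybe ℕ²
positivePart (+ zero , + zero) = nothing
positivePart (+ m , + n) = just (m , n)
positivePart _ = nothing

positivePart-toℤ² : ∀ {p} → p ≢ (0 , 0) → positivePart (toℤ² p) ≡ just p
positivePart-toℤ² {zero , zero} p≢0 = contradiction refl p≢0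
positivePart-toℤ² {zero , suc _} _ = refl
positivePart-toℤ² {suc _ , _} _ = refl

positivePart-negᵥ-toℤ² : ∀ {p} → p ≢ (0 , 0) → positivePart (negᵥ (toℤ² p)) ≡ nothing
positivePart-negᵥ-toℤ² {zero , zero} p≢0 = contradiction refl p≢0
positivePart-negᵥ-toℤ² {zero , suc _} _ = refl
positivePart-negᵥ-toℤ² {suc _ , _} _ = refl

symmetrised : List ℕ² → ℕ → List ℤ²
symmetrised X n = map toℤ² X ++ map negᵥ (map toℤ² X) ++ replicate n 0ᵥ

symmetrised-↭ : ∀ {X Y} → X ↭ Y → ∀ n → symmetrised X n ↭ symmetrised Y n
symmetrised-↭ X↭Y n = ↭.++⁺ (↭.map⁺ toℤ² X↭Y) (↭.++⁺ (↭.map⁺ negᵥ (↭.map⁺ toℤ² X↭Y)) ↭-refl)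

mapMaybe-positivePart-symmetrised : ∀ X n → All (_≢ (0 , 0)) X →
                                    mapMaybe positivePart (symmetrised X n) ≡ X
mapMaybe-positivePart-symmetrised X n X≢0 = begin
  mapMaybe positivePart (X′ ++ map negᵥ X′ ++ replicate n 0ᵥ)
    ≡⟨ mapMaybe-++ positivePart X′ _ ⟩
  mapMaybe positivePart X′ ++ mapMaybe positivePart (map negᵥ X′ ++ replicate n 0ᵥ)
    ≡⟨ cong (mapMaybe positivePart X′ ++_) (mapMaybe-++ positivePart (map negᵥ X′) _) ⟩
  mapMaybe positivePart X′ ++ mapMaybe positivePart (map negᵥ X′) ++ mapMaybe positivePart (replicate n 0ᵥ)
    ≡⟨ cong₂ _++_ positives (cong₂ _++_ negatives zeros) ⟩
  X ++ [] ++ []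
    ≡⟨ ++-identityʳ X ⟩
  X ∎
  where
  open ≡-Reasoning
  X′ : List ℤ²
  X′ = map toℤ² X
  positives : mapMaybe positivePart X′ ≡ X
  positives = trans (mapMaybe-map positivePart toℤ² X)
    (trans (mapMaybe-cong-local (All.map positivePart-toℤ² X≢0)) (mapMaybe-just X))
  negatives : mapMaybe positivePart (map negᵥ X′) ≡ []
  negatives = trans (cong (mapMaybe positivePart) (sym (map-∘ X)))
    (trans (mapMaybe-map positivePart (negᵥ ∘ toℤ²) X)
    (trans (mapMaybe-cong-local (All.map positivePart-negᵥ-toℤ² X≢0)) (mapMaybe-nothing X)))
  zeros : mapMaybe positivePart (replicate n 0ᵥ) ≡ []
  zeros = trans (mapMaybe-cong-local {g = λ _ → nothing} (All.replicate⁺ n refl))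
    (mapMaybe-nothing (replicate n 0ᵥ))

monomial : ℕ² → Term
monomial p = (ℤ.1ℤ , proj₁ p , proj₂ p)

monomials : List ℕ² → Poly
monomials = map monomial

-- Relates the two coordinate tests made by coeff to the single test on pairs made by count.
indicator-×-dec : ∀ {P Q : Set} (p? : Dec P) (q? : Dec Q) →
  (if ⌊ p? ⌋ then (if ⌊ q? ⌋ then ℤ.1ℤ else ℤ.0ℤ) else ℤ.0ℤ) ≡ + (if does (p? ×-dec q?) then 1 else 0)
indicator-×-dec (yes _) (yes _) = refl
indicator-×-dec (yes _) (no _) = refl
indicator-×-dec (no _) _ = refl

coeff-monomials : ∀ L a b → coeff (monomials L) a b ≡ + count (a , b) L
coeff-monomials [] a b = refl
coeff-monomials ((i , j) ∷ L) a b = begin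
  coeff (monomials ((i , j) ∷ L)) a b
    ≡⟨ cong₂ ℤ._+_ (indicator-×-dec (i ℕ.≟ a) (j ℕ.≟ b)) (coeff-monomials L a b) ⟩
  + hit ℤ.+ + count (a , b) L
    ≡⟨ ℤ.pos-+ hit (count (a , b) L) ⟨
  + count (a , b) ((i , j) ∷ L) ∎
  where
  open ≡-Reasoning
  hit : ℕ
  hit = if does ((i , j) ≟₂ (a , b)) then 1 else 0

monomials-≈ₚ⇔↭ : ∀ L M → monomials L ≈ₚ monomials M ⇔ (L ↭ M)
monomials-≈ₚ⇔↭ L M = mk⇔
  (λ L≈M → count⇒↭ L M λ (a , b) →
    ℤ.+-injective (trans (sym (coeff-monomials L a b)) (trans (L≈M a b) (coeff-monomials M a b))))
  (λ L↭M a b →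
    trans (coeff-monomials L a b) (trans (cong +_ (count-↭ L↭M (a , b))) (sym (coeff-monomials M a b))))

-- Generalised over sublists Q of L so that the coefficients tested stay those of L.
degree-monomials : ∀ (π : ℕ² → ℕ) L Q → (∀ {q} → q ∈ Q → q ∈ L) →
  foldr (λ { (_ , i , j) m → if ⌊ coeff (monomials L) i j ℤ.≟ ℤ.0ℤ ⌋ then m else π (i , j) ⊔ m }) 0 (monomials Q)
    ≡ foldr _⊔_ 0 (map π Q)
degree-monomials π L [] _ = refl
degree-monomials π L (q ∷ Q) Q⊆L rewrite coeff-monomials L (proj₁ q) (proj₂ q)
  with count q L | count-∈⁺ (Q⊆L (here refl))
... | suc _ | _ = cong (π q ⊔_) (degree-monomials π L Q (Q⊆L ∘ there))

degrees-monomials : ∀ L → (degx (monomials L) , degy (monomials L)) ≡ sup L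
degrees-monomials L =
  cong₂ _,_ (degree-monomials proj₁ L L (λ q∈L → q∈L)) (degree-monomials proj₂ L L (λ q∈L → q∈L))

reciprocal-monomials : ∀ L → reciprocal (monomials L) ≡ monomials (map (sup L ∸₂_) L)
reciprocal-monomials L = begin
  reciprocal (monomials L)
    ≡⟨ trans (sym (map-∘ L)) (map-∘ L) ⟩
  monomials (map ((degx (monomials L) , degy (monomials L)) ∸₂_) L)
    ≡⟨ cong (λ d → monomials (map (d ∸₂_) L)) (degrees-monomials L) ⟩
  monomials (map (sup L ∸₂_) L) ∎
  where open ≡-Reasoning

monomials-*ₚ : ∀ X Y → monomials X *ₚ monomials Y ≡ monomials (cartesianProductWith _+₂_ X Y)
monomials-*ₚ [] Y = refl
monomials-*ₚ (x ∷ X) Y = begin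
  monomials (x ∷ X) *ₚ monomials Y
    ≡⟨ cong₂ _++_ (trans (sym (map-∘ Y)) (map-∘ Y)) (monomials-*ₚ X Y) ⟩
  monomials (map (x +₂_) Y) ++ monomials (cartesianProductWith _+₂_ X Y)
    ≡⟨ map-++ monomial (map (x +₂_) Y) _ ⟨
  monomials (cartesianProductWith _+₂_ (x ∷ X) Y) ∎
  where open ≡-Reasoning

-- Prefix points of a binary string

unit : Bool → ℕ²
unit false = (1 , 0)
unit true = (0 , 1)

comp-∷ : ∀ c w → comp (c ∷ w) ≡ unit c +₂ comp w
comp-∷ false w with comp w
... | _ = refl
comp-∷ true w with comp w
... | _ = refl

prefixPoints : BinStr → List ℕ²
prefixPoints s = map comp ([] ∷ nePrefixes s)

comp-nePrefixes-∷ : ∀ c s → map comp (nePrefixes (c ∷ s)) ≡ map (unit c +₂_) (prefixPoints s)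
comp-nePrefixes-∷ c s =
  trans (sym (map-∘ prefixes)) (trans (map-cong (comp-∷ c) prefixes) (map-∘ prefixes))
  where
  prefixes : List BinStr
  prefixes = [] ∷ nePrefixes s

prefixPoints-∷ : ∀ c s → prefixPoints (c ∷ s) ≡ (0 , 0) ∷ map (unit c +₂_) (prefixPoints s)
prefixPoints-∷ c s = cong ((0 , 0) ∷_) (comp-nePrefixes-∷ c s)

compositions-∷ : ∀ c s → compositions (c ∷ s) ≡ map (unit c +₂_) (prefixPoints s) ++ compositions s
compositions-∷ c s =
  trans (map-++ comp (nePrefixes (c ∷ s)) (substrings s)) (cong (_++ compositions s) (comp-nePrefixes-∷ c s))

genPoly-monomials : ∀ s → genPoly s ≡ monomials (prefixPoints s)
genPoly-monomials [] = refl
genPoly-monomials (false ∷ s) = trans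
  (cong (_ ∷_) (trans (cong (map _) (genPoly-monomials s)) (trans (sym (map-∘ _)) (map-∘ _))))
  (cong monomials (sym (prefixPoints-∷ false s)))
genPoly-monomials (true ∷ s) = trans
  (cong (_ ∷_) (trans (cong (map _) (genPoly-monomials s)) (trans (sym (map-∘ _)) (map-∘ _))))
  (cong monomials (sym (prefixPoints-∷ true s)))

prefixPoints-≤₂ : ∀ s → All (_≤₂ comp s) (prefixPoints s)
prefixPoints-≤₂ [] = (z≤n , z≤n) ∷ []
prefixPoints-≤₂ (c ∷ s) = subst₂ (λ P T → All (_≤₂ T) P) (sym (prefixPoints-∷ c s)) (sym (comp-∷ c s))
  ((z≤n , z≤n) ∷ All.map⁺ (All.map (+₂-monoʳ-≤₂ (unit c)) (prefixPoints-≤₂ s)))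

comp-∈-prefixPoints : ∀ s → comp s ∈ prefixPoints s
comp-∈-prefixPoints s = ∈-map⁺ comp (∈-prefixes s)
  where
  ∈-prefixes : ∀ s → s ∈ [] ∷ nePrefixes s
  ∈-prefixes [] = here refl
  ∈-prefixes (c ∷ s) = there (∈-map⁺ (c ∷_) (∈-prefixes s))

sup-prefixPoints : ∀ s → sup (prefixPoints s) ≡ comp s
sup-prefixPoints s = sup-attained (comp-∈-prefixPoints s) (prefixPoints-≤₂ s)

length-prefixPoints : ∀ s → length (prefixPoints s) ≡ suc (length s)
length-prefixPoints s = cong suc (trans (length-map comp (nePrefixes s)) (length-nePrefixes s))
  where
  length-nePrefixes : ∀ s → length (nePrefixes s) ≡ length s
  length-nePrefixes [] = refl
  length-nePrefixes (c ∷ s) = cong suc (trans (length-map (c ∷_) (nePrefixes s)) (length-nePrefixes s))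

weight-comp : ∀ s → proj₁ (comp s) + proj₂ (comp s) ≡ length s
weight-comp [] = refl
weight-comp (c ∷ s) rewrite comp-∷ c s = trans (weight-unit c (comp s)) (cong suc (weight-comp s))
  where
  weight-unit : ∀ c p → proj₁ (unit c +₂ p) + proj₂ (unit c +₂ p) ≡ suc (proj₁ p + proj₂ p)
  weight-unit false p = refl
  weight-unit true p = ℕ.+-suc (proj₁ p) (proj₂ p)

compositions-≤₂ : ∀ s → All (_≤₂ comp s) (compositions s)
compositions-≤₂ [] = []
compositions-≤₂ (c ∷ s) = subst₂ (λ C T → All (_≤₂ T) C) (sym (compositions-∷ c s)) (sym (comp-∷ c s))
  (All.++⁺ (All.map⁺ (All.map (+₂-monoʳ-≤₂ (unit c)) (prefixPoints-≤₂ s)))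
           (All.map (p≤₂q⇒p≤₂u+₂q (unit c)) (compositions-≤₂ s)))

sup-compositions : ∀ s → sup (compositions s) ≡ comp s
sup-compositions [] = refl
sup-compositions (c ∷ s) = sup-attained comp∈ (compositions-≤₂ (c ∷ s))
  where
  comp∈ : comp (c ∷ s) ∈ compositions (c ∷ s)
  comp∈ = subst₂ _∈_ (sym (comp-∷ c s)) (sym (compositions-∷ c s))
    (∈-++⁺ˡ (∈-map⁺ (unit c +₂_) (comp-∈-prefixPoints s)))

unit-+₂-≢-0 : ∀ c p → unit c +₂ p ≢ (0 , 0)
unit-+₂-≢-0 false p ()
unit-+₂-≢-0 true p ()

compositions-≢-0 : ∀ s → All (_≢ (0 , 0)) (compositions s)
compositions-≢-0 [] = []
compositions-≢-0 (c ∷ s) = subst (All (_≢ (0 , 0))) (sym (compositions-∷ c s))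
  (All.++⁺ (All.map⁺ (All.universal (unit-+₂-≢-0 c) _)) (compositions-≢-0 s))

-- The exponents of P_s P_s*

productExponents : BinStr → List ℕ²
productExponents s = cartesianProductWith _+₂_ (prefixPoints s) (map (comp s ∸₂_) (prefixPoints s))

genPoly-*ₚ-reciprocal : ∀ s → genPoly s *ₚ reciprocal (genPoly s) ≡ monomials (productExponents s)
genPoly-*ₚ-reciprocal s = begin
  genPoly s *ₚ reciprocal (genPoly s)
    ≡⟨ cong (λ p → p *ₚ reciprocal p) (genPoly-monomials s) ⟩
  monomials P *ₚ reciprocal (monomials P)
    ≡⟨ cong (monomials P *ₚ_) (reciprocal-monomials P) ⟩
  monomials P *ₚ monomials (map (sup P ∸₂_) P)
    ≡⟨ cong (λ T → monomials P *ₚ monomials (map (T ∸₂_) P)) (sup-prefixPoints s) ⟩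
  monomials P *ₚ monomials (map (comp s ∸₂_) P)
    ≡⟨ monomials-*ₚ P _ ⟩
  monomials (productExponents s) ∎
  where
  open ≡-Reasoning
  P : List ℕ²
  P = prefixPoints s

sup-productExponents : ∀ s → sup (productExponents s) ≡ comp s +₂ comp s
sup-productExponents s = sup-attained
  (∈-cartesianProductWith⁺ _+₂_ (comp-∈-prefixPoints s) (∈-map⁺ (comp s ∸₂_) {x = 0 , 0} (here refl)))
  (All.cartesianProductWith⁺ (setoid ℕ²) (setoid ℕ²) _+₂_ P (map (comp s ∸₂_) P) λ p∈P q∈Q →
    let (p₁≤ , p₂≤) = All.lookup (prefixPoints-≤₂ s) p∈P
        (q₁≤ , q₂≤) = All.lookup Q≤ q∈Q
    in ℕ.+-mono-≤ p₁≤ q₁≤ , ℕ.+-mono-≤ p₂≤ q₂≤)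
  where
  P : List ℕ²
  P = prefixPoints s
  Q≤ : All (_≤₂ comp s) (map (comp s ∸₂_) P)
  Q≤ = All.map⁺ (All.universal (λ p → ℕ.m∸n≤m _ (proj₁ p) , ℕ.m∸n≤m _ (proj₂ p)) P)

increments-prefixPoints : ∀ s → increments (map toℤ² (prefixPoints s)) ≡ map toℤ² (compositions s)
increments-prefixPoints [] = refl
increments-prefixPoints (c ∷ s) = begin
  increments (map toℤ² (prefixPoints (c ∷ s)))
    ≡⟨ cong (increments ∘ map toℤ²) (prefixPoints-∷ c s) ⟩
  map (_-ᵥ 0ᵥ) Y ++ increments Y
    ≡⟨ cong₂ _++_ (trans (map-cong x-ᵥ0ᵥ≡x Y) (map-id Y))
                  (trans (cong increments Y≡) (increments-+ᵥ (toℤ² (unit c)) (map toℤ² P))) ⟩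
  Y ++ increments (map toℤ² P)
    ≡⟨ cong (Y ++_) (increments-prefixPoints s) ⟩
  Y ++ map toℤ² (compositions s)
    ≡⟨ trans (cong (map toℤ²) (compositions-∷ c s))
             (map-++ toℤ² (map (unit c +₂_) P) (compositions s)) ⟨
  map toℤ² (compositions (c ∷ s)) ∎
  where
  open ≡-Reasoning
  P : List ℕ²
  P = prefixPoints s
  Y : List ℤ²
  Y = map toℤ² (map (unit c +₂_) P)
  Y≡ : Y ≡ map (toℤ² (unit c) +ᵥ_) (map toℤ² P)
  Y≡ = trans (sym (map-∘ P)) (map-∘ P)

prefixDifferences : BinStr → List ℤ²
prefixDifferences s = differences (map toℤ² (prefixPoints s))

toℤ²-productExponents : ∀ s →
  map toℤ² (productExponents s) ≡ map (toℤ² (comp s) +ᵥ_) (prefixDifferences s)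
toℤ²-productExponents s =
  toℤ²-cartesianProductWith (comp s) (prefixPoints s) (prefixPoints s) (prefixPoints-≤₂ s)

prefixDifferences-↭ : ∀ s → prefixDifferences s ↭ symmetrised (compositions s) (suc (length s))
prefixDifferences-↭ s =
  subst₂ (λ C n → prefixDifferences s ↭ C ++ map negᵥ C ++ replicate n 0ᵥ)
    (increments-prefixPoints s) (trans (length-map toℤ² (prefixPoints s)) (length-prefixPoints s))
    (differences-↭ (map toℤ² (prefixPoints s)))

SameDifferences : BinStr → BinStr → Set
SameDifferences s t = comp s ≡ comp t × prefixDifferences s ↭ prefixDifferences t

equicomposable⇔ : ∀ s t → Equicomposable s t ⇔ SameDifferences s t
equicomposable⇔ s t = mk⇔ to from
  where
  to : Equicomposable s t → SameDifferences s t
  to C↭ = comp≡ , (begin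
    prefixDifferences s                               ↭⟨ prefixDifferences-↭ s ⟩
    symmetrised (compositions s) (suc (length s))     ↭⟨ symmetrised-↭ C↭ (suc (length s)) ⟩
    symmetrised (compositions t) (suc (length s))     ≡⟨ cong (symmetrised (compositions t) ∘ suc) length≡ ⟩
    symmetrised (compositions t) (suc (length t))     ↭⟨ prefixDifferences-↭ t ⟨
    prefixDifferences t                               ∎)
    where
    open PermutationReasoning
    comp≡ : comp s ≡ comp t
    comp≡ = trans (sym (sup-compositions s)) (trans (sup-↭ C↭) (sup-compositions t))
    length≡ : length s ≡ length t
    length≡ = trans (sym (weight-comp s)) (trans (cong (λ T → proj₁ T + proj₂ T) comp≡) (weight-comp t))
  from : SameDifferences s t → Equicomposable s t
  from (_ , D↭) = subst₂ _↭_ (positiveParts s) (positiveParts t)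
    (↭.mapMaybe-↭ positivePart
      (↭-trans (↭-sym (prefixDifferences-↭ s)) (↭-trans D↭ (prefixDifferences-↭ t))))
    where
    positiveParts : ∀ s →
      mapMaybe positivePart (symmetrised (compositions s) (suc (length s))) ≡ compositions s
    positiveParts s =
      mapMaybe-positivePart-symmetrised (compositions s) (suc (length s)) (compositions-≢-0 s)

productExponents-↭⇔ : ∀ s t →
  (productExponents s ↭ productExponents t) ⇔ SameDifferences s t
productExponents-↭⇔ s t = mk⇔ to from
  where
  translated : comp s ≡ comp t →
    map toℤ² (productExponents t) ≡ map (toℤ² (comp s) +ᵥ_) (prefixDifferences t)
  translated comp≡ =
    subst (λ T → map toℤ² (productExponents t) ≡ map (toℤ² T +ᵥ_) (prefixDifferences t))
          (sym comp≡) (toℤ²-productExponents t)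
  to : productExponents s ↭ productExponents t → SameDifferences s t
  to L↭ = comp≡ , ↭-map⁻ (_-ᵥ toℤ² (comp s)) ([w+ᵥx]-ᵥw≡x (toℤ² (comp s)))
    (subst₂ _↭_ (toℤ²-productExponents s) (translated comp≡) (↭.map⁺ toℤ² L↭))
    where
    doubled : comp s +₂ comp s ≡ comp t +₂ comp t
    doubled = trans (sym (sup-productExponents s)) (trans (sup-↭ L↭) (sup-productExponents t))
    comp≡ : comp s ≡ comp t
    comp≡ = cong₂ _,_ (m+m≡n+n⇒m≡n (cong proj₁ doubled)) (m+m≡n+n⇒m≡n (cong proj₂ doubled))
  from : SameDifferences s t → productExponents s ↭ productExponents t
  from (comp≡ , D↭) = ↭-map⁻ fromℤ² (λ _ → refl)
    (subst₂ _↭_ (sym (toℤ²-productExponents s)) (sym (translated comp≡))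
                (↭.map⁺ (toℤ² (comp s) +ᵥ_) D↭))
    where
    fromℤ² : ℤ² → ℕ²
    fromℤ² v = (ℤ.∣ proj₁ v ∣ , ℤ.∣ proj₂ v ∣)

lemma3 : (s t : BinStr) →
    Equicomposable s t ⇔ ((genPoly s *ₚ reciprocal (genPoly s)) ≈ₚ (genPoly t *ₚ reciprocal (genPoly t)))
lemma3 s t rewrite genPoly-*ₚ-reciprocal s | genPoly-*ₚ-reciprocal t =
  ⇔.trans (equicomposable⇔ s t)
  (⇔.trans (⇔.sym (productExponents-↭⇔ s t))
           (⇔.sym (monomials-≈ₚ⇔↭ (productExponents s) (productExponents t))))
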